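{- Let $n\ge2$, $0<k\le n/2$, let $\alpha$ be a positive $k$-root and $w\in S_n$. If $w(\alpha)$ is negative, then the normal form of $\alpha$ contains a factor $(x_i-x_j)$ (with $i<j$) for which $w(i)>w(j)$.
   Context: $V_{n,k}$ is the $\mathbb{Q}$-vector space with basis the squarefree degree-$k$ monomials in $x_1,\dots,x_n$, with $S_n$ acting by $w(x_i)=x_{w(i)}$. Monomials are ordered lexicographically: for distinct $k$-subsets $I,J$ with $t=\min(I\,\Delta\,J)$, $x_I\prec x_J$ iff $t\in I$. A nonzero $v$ is positive if the $\prec$-minimal monomial in $v$ has positive coefficient, and negative otherwise. A $k$-root is a product $\prod_{r=1}^k(\pm x_{i_{2r-1}}\pm x_{i_{2r}})$ with independent signs and $2k$ distinct indices; it is positive or negative according to its sign in $V_{n,k}$. Each positive $k$-root can be written uniquely up to order of factors as $\prod_{r=1}^k(x_{i_{2r-1}}\pm x_{i_{2r}})$ with $i_{2r-1}<i_{2r}$ (its normal form). -}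

module Defs where

open import Data.Nat using (ℕ)
open import Data.Bool using (Bool; true; false)
open import Data.Fin using (Fin; _<_; _>_)
open import Data.Fin.Subset using (Subset; _∈_; _∉_; ∣_∣; ⊥)
open import Data.Fin.Permutation using (Permutation′; _⟨$⟩ʳ_; _⟨$⟩ˡ_)
open import Data.Integer using (ℤ; +_; -[1+_]; _*_; _+_; 0ℤ; 1ℤ)
open import Data.Sign using (Sign) renaming (+ to plus; - to minus)
open import Data.Vec using (tabulate; lookup; _[_]≔_)
open import Data.Vec.Properties using (≡-dec)
open import Data.List using (List; []; _∷_; map; concatMap; length)
open import Data.List.Relation.Unary.All using (All)
open import Data.List.Relation.Unary.Unique.Propositional using (Unique)
open import Data.Product using (Σ; _×_; _,_)
open import Relation.Binary.PropositionalEquality using (_≡_)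
open import Relation.Nullary using (yes; no)
import Data.Bool.Properties as BoolP

-- Monomials x_I (I ⊆ {1..n}) are represented by subsets I : Subset n.
Monomial : ℕ → Set
Monomial n = Subset n

-- Lexicographic order: x_I ≺ x_J iff t := min (I Δ J) lies in I.
-- Spelled out: t ∈ I, t ∉ J, and I, J agree on all s < t.
_≺_ : {n : ℕ} → Monomial n → Monomial n → Set
_≺_ {n} I J =
  Σ (Fin n) λ t → (t ∈ I) × (t ∉ J) ×
    (∀ (s : Fin n) → s < t → ((s ∈ I → s ∈ J) × (s ∈ J → s ∈ I)))

-- An element of V_{n,k} (or of the ambient space) given as a formal
-- ℤ-linear combination of monomials (ℚ-coefficients are not needed:
-- all vectors considered have integer coefficients).
Vect : ℕ → Set
Vect n = List (ℤ × Monomial n)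

coeff : {n : ℕ} → Vect n → Monomial n → ℤ
coeff [] I = 0ℤ
coeff ((c , J) ∷ v) I with ≡-dec BoolP._≟_ J I
... | yes _ = c + coeff v I
... | no  _ = coeff v I

Positive : {n : ℕ} → ℕ → Vect n → Set
Positive {n} k v = Σ (Monomial n) λ I → (∣ I ∣ ≡ k) × (+ 0 Data.Integer.< coeff v I) ×
  (∀ (J : Monomial n) → ∣ J ∣ ≡ k → J ≺ I → coeff v J ≡ 0ℤ)

Negative : {n : ℕ} → ℕ → Vect n → Set
Negative {n} k v = Σ (Monomial n) λ I → (∣ I ∣ ≡ k) × (coeff v I Data.Integer.< + 0) ×
  (∀ (J : Monomial n) → ∣ J ∣ ≡ k → J ≺ I → coeff v J ≡ 0ℤ)

image : {n : ℕ} → Permutation′ n → Monomial n → Monomial n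
image w I = tabulate λ t → lookup I (w ⟨$⟩ˡ t)

act : {n : ℕ} → Permutation′ n → Vect n → Vect n
act w v = map (λ { (c , I) → (c , image w I) }) v

sgn : Sign → ℤ
sgn plus  = 1ℤ
sgn minus = -[1+ 0 ]

-- A factor (x_i + s x_j) of a normal form, stored as (i , j , s).
Factor : ℕ → Set
Factor n = Fin n × Fin n × Sign

-- Multiply a vector by the linear form (x_i + s x_j)
-- (x_I · x_i is x_{I ∪ {i}}; all products used are squarefree
-- because the indices of a root are distinct).
mulFactor : {n : ℕ} → Factor n → Vect n → Vect n
mulFactor (i , j , s) v =
  concatMap (λ { (c , I) → (c , I [ i ]≔ true) ∷ (sgn s * c , I [ j ]≔ true) ∷ [] }) v

expand : {n : ℕ} → List (Factor n) → Vect n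
expand [] = (1ℤ , ⊥) ∷ []
expand (f ∷ fs) = mulFactor f (expand fs)

indices : {n : ℕ} → List (Factor n) → List (Fin n)
indices = concatMap (λ { (i , j , s) → i ∷ j ∷ [] })

record NormalForm (n k : ℕ) : Set where
  field
    factors  : List (Factor n)
    len      : length factors ≡ k
    ordered  : All (λ { (i , j , s) → i < j }) factors
    distinct : Unique (indices factors)
open NormalForm public

rootVec : {n k : ℕ} → NormalForm n k → Vect n
rootVec α = expand (factors α)

-- Write the factors of w(α) as (x_p ± x_q) with p = w(i), q = w(j). Choosing the smaller
-- of p, q in every factor gives the ≺-least monomial of w(α): any other choice first
-- differs in some factor, where it takes the larger index. That monomial arises only once,
-- with coefficient the product of the signs of the factors with q < p. So if w(α) is
-- negative, one of these factors carries a minus sign, i.e. α has a factor (x_i - x_j)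
-- with w(i) > w(j). Only the distinctness of the 2k indices is used: not the positivity
-- of α, not i < j, nor the bounds on n and k.
module Submission where

open import Defs
open import Data.Nat using (ℕ; suc; _≤_; _<_; _*_)
open import Data.Bool using (true; false)
open import Data.Fin using (Fin; zero; suc; _>_) renaming (_<_ to _<ᶠ_)
open import Data.Fin.Properties using (_≟_; <-cmp; <-trans; <⇒≢)
open import Data.Fin.Subset using (Subset; ∣_∣) renaming (⊥ to ∅)
open import Data.Fin.Subset.Properties using (∣⊥∣≡0)
open import Data.Fin.Permutation using (Permutation′; _⟨$⟩ʳ_; _⟨$⟩ˡ_; inverseˡ; inverseʳ)
open import Data.Integer using (ℤ; 0ℤ; 1ℤ; -1ℤ; +<+) renaming (_*_ to _*ℤ_; _+_ to _+ℤ_; _<_ to _<ℤ_)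
import Data.Integer.Properties as ℤ
open import Data.Sign using (Sign) renaming (+ to plus; - to minus)
open import Data.Vec using ([]; _∷_; lookup; _[_]≔_)
open import Data.Vec.Properties using (≡-dec; lookup⇒[]=; []=⇒lookup; lookup∘update; lookup∘update′; tabulate∘lookup; tabulate-cong; lookup∘tabulate; lookup-replicate)
open import Data.List using (List; []; _∷_; map; length)
open import Data.List.Properties using (length-map)
open import Data.List.Relation.Unary.All as All using (All; []; _∷_)
open import Data.List.Relation.Unary.Any using (here; there)
open import Data.List.Relation.Unary.AllPairs using (_∷_)
open import Data.List.Relation.Unary.Unique.Propositional using (Unique)
import Data.List.Relation.Unary.Unique.Propositional.Properties as Unique
open import Data.List.Membership.Propositional using (_∈_)
open import Data.List.Membership.Propositional.Properties using (∈-map⁻)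
open import Data.Product using (Σ; _×_; _,_; proj₂; ∃; ∃₂; map₁; map₂)
open import Data.Sum using (_⊎_; inj₁; inj₂)
open import Data.Empty using (⊥-elim)
open import Function using (_∘_)
open import Relation.Binary.PropositionalEquality using (_≡_; _≢_; refl; sym; trans; cong; cong₂; subst; module ≡-Reasoning)
open import Relation.Binary.Definitions using (tri<; tri≈; tri>)
open import Relation.Nullary using (Dec; yes; no)
import Data.Bool.Properties as Bool

private
  variable
    n : ℕ
    I J : Subset n
    p q s x : Fin n
    e : ℤ
    σ : Sign
    gs : List (Factor n)

insert : Subset n → Fin n → Subset n
insert I x = I [ x ]≔ true

subset-ext : (∀ t → lookup I t ≡ lookup J t) → I ≡ J
subset-ext {I = I} {J = J} eq =
  trans (sym (tabulate∘lookup I)) (trans (tabulate-cong eq) (tabulate∘lookup J))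

lookup-∅ : (x : Fin n) → lookup ∅ x ≡ false
lookup-∅ x = lookup-replicate x false

lookup-insert : (I : Subset n) (x : Fin n) → lookup (insert I x) x ≡ true
lookup-insert I x = lookup∘update x I true

lookup-insert-≢ : (I : Subset n) → x ≢ s → lookup (insert I x) s ≡ lookup I s
lookup-insert-≢ I x≢s = lookup∘update′ (x≢s ∘ sym) I true

lookup-insert-< : (I : Subset n) → s <ᶠ x → lookup (insert I x) s ≡ lookup I s
lookup-insert-< I s<x = lookup-insert-≢ I (<⇒≢ s<x ∘ sym)

lookup-insert-cong : (I J : Subset n) (x s : Fin n) → lookup I s ≡ lookup J s →
  lookup (insert I x) s ≡ lookup (insert J x) s
lookup-insert-cong I J x s eq with x ≟ s
... | yes refl = trans (lookup-insert I x) (sym (lookup-insert J x))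
... | no x≢s = trans (lookup-insert-≢ I x≢s) (trans eq (sym (lookup-insert-≢ J x≢s)))

insert-cancel : lookup I x ≡ false → lookup J x ≡ false → insert I x ≡ insert J x → I ≡ J
insert-cancel {I = I} {x = x} {J = J} Ix Jx eq = subset-ext pointwise
  where
  pointwise : ∀ t → lookup I t ≡ lookup J t
  pointwise t with x ≟ t
  ... | yes refl = trans Ix (sym Jx)
  ... | no x≢t = trans (sym (lookup-insert-≢ I x≢t))
                   (trans (cong (λ K → lookup K t) eq) (lookup-insert-≢ J x≢t))

insert-≢ : lookup I q ≡ false → p ≢ q → insert J q ≢ insert I p
insert-≢ {I = I} {q = q} {p = p} {J = J} Iq p≢q eq
  with trans (sym (lookup-insert J q))
             (trans (cong (λ K → lookup K q) eq) (trans (lookup-insert-≢ I p≢q) Iq))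
... | ()

∣insert∣ : (I : Subset n) (x : Fin n) → lookup I x ≡ false → ∣ insert I x ∣ ≡ suc ∣ I ∣
∣insert∣ (false ∷ I) zero refl = refl
∣insert∣ (true  ∷ I) (suc x) Ix = cong suc (∣insert∣ I x Ix)
∣insert∣ (false ∷ I) (suc x) Ix = ∣insert∣ I x Ix

_⊏_ : Subset n → Subset n → Set
_⊏_ {n} I J = ∃ λ (t : Fin n) →
  lookup I t ≡ true × lookup J t ≡ false × (∀ s → s <ᶠ t → lookup I s ≡ lookup J s)

_⊑_ : Subset n → Subset n → Set
I ⊑ J = I ≡ J ⊎ I ⊏ J

⊏⇒≺ : I ⊏ J → I ≺ J
⊏⇒≺ {I = I} {J = J} (t , It , Jt , agree) =
  t , lookup⇒[]= t I It , (λ t∈J → true≢false (trans (sym ([]=⇒lookup t∈J)) Jt)) ,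
  λ s s<t → (λ s∈I → lookup⇒[]= s J (trans (sym (agree s s<t)) ([]=⇒lookup s∈I))) ,
            (λ s∈J → lookup⇒[]= s I (trans (agree s s<t) ([]=⇒lookup s∈J)))
  where
  true≢false : true ≢ false
  true≢false ()

insert-mono-⊑ : lookup I x ≡ false → I ⊑ J → insert I x ⊑ insert J x
insert-mono-⊑ _ (inj₁ refl) = inj₁ refl
insert-mono-⊑ {I = I} {x = x} {J = J} Ix (inj₂ (t , It , Jt , agree)) =
  inj₂ (t , trans (lookup-insert-≢ I x≢t) It , trans (lookup-insert-≢ J x≢t) Jt ,
        λ s s<t → lookup-insert-cong I J x s (agree s s<t))
  where
  x≢t : x ≢ t
  x≢t refl with trans (sym It) Ix
  ... | ()

-- The first difference is at m, unless I and J already differ below m.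
insert-⊏-insert : {I J : Subset n} {m M : Fin n} → m <ᶠ M → lookup I m ≡ false → lookup J m ≡ false →
  I ⊑ J → insert I m ⊏ insert J M
insert-⊏-insert {I = I} {m = m} m<M Im Jm (inj₁ refl) =
  m , lookup-insert I m , trans (lookup-insert-< I m<M) Im ,
  λ s s<m → trans (lookup-insert-< I s<m) (sym (lookup-insert-< I (<-trans s<m m<M)))
insert-⊏-insert {I = I} {J = J} {m = m} m<M Im Jm (inj₂ (t , It , Jt , agree)) with <-cmp t m
... | tri< t<m _ _ =
  t , trans (lookup-insert-< I t<m) It , trans (lookup-insert-< J (<-trans t<m m<M)) Jt ,
  λ s s<t → trans (lookup-insert-< I (<-trans s<t t<m))
              (trans (agree s s<t) (sym (lookup-insert-< J (<-trans (<-trans s<t t<m) m<M))))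
... | tri≈ _ refl _ with trans (sym It) Im
...   | ()
insert-⊏-insert {I = I} {J = J} {m = m} m<M Im Jm (inj₂ (t , It , Jt , agree)) | tri> _ _ m<t =
  m , lookup-insert I m , trans (lookup-insert-< J m<M) Jm ,
  λ s s<m → trans (lookup-insert-< I s<m)
              (trans (agree s (<-trans s<m m<t)) (sym (lookup-insert-< J (<-trans s<m m<M))))

coeff-head : (c : ℤ) (I : Subset n) (v : Vect n) → coeff ((c , I) ∷ v) I ≡ c +ℤ coeff v I
coeff-head c I v with ≡-dec Bool._≟_ I I
... | yes _ = refl
... | no I≢I = ⊥-elim (I≢I refl)

coeff-skip : (c : ℤ) (J I : Subset n) (v : Vect n) → J ≢ I → coeff ((c , J) ∷ v) I ≡ coeff v I
coeff-skip c J I v J≢I with ≡-dec Bool._≟_ J I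
... | yes J≡I = ⊥-elim (J≢I J≡I)
... | no _ = refl

coeff≢0⇒∈ : (v : Vect n) (I : Subset n) → coeff v I ≢ 0ℤ → ∃ λ c → (c , I) ∈ v
coeff≢0⇒∈ [] I ≢0 = ⊥-elim (≢0 refl)
coeff≢0⇒∈ ((c , J) ∷ v) I ≢0 with ≡-dec Bool._≟_ J I
... | yes refl = c , here refl
... | no _ = map₂ there (coeff≢0⇒∈ v I ≢0)

Avoids : Fin n → Vect n → Set
Avoids x = All (λ term → lookup (proj₂ term) x ≡ false)

coeff-mulFactor-insert-left : p ≢ q → lookup I p ≡ false → lookup I q ≡ false →
  (v : Vect n) → Avoids p v → coeff (mulFactor (p , q , σ) v) (insert I p) ≡ coeff v I
coeff-mulFactor-insert-left p≢q Ip Iq [] [] = refl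
coeff-mulFactor-insert-left {p = p} {q = q} {I = I} {σ = σ} p≢q Ip Iq ((c , J) ∷ v) (Jp ∷ avoids) =
  begin
    coeff ((c , insert J p) ∷ (sgn σ *ℤ c , insert J q) ∷ rest) (insert I p)
      ≡⟨ step (≡-dec Bool._≟_ J I) ⟩
    coeff ((c , J) ∷ v) I ∎
  where
  open ≡-Reasoning
  rest : Vect _
  rest = mulFactor (p , q , σ) v
  rest-coeff : coeff ((sgn σ *ℤ c , insert J q) ∷ rest) (insert I p) ≡ coeff v I
  rest-coeff = trans (coeff-skip _ (insert J q) (insert I p) rest (insert-≢ Iq p≢q))
                     (coeff-mulFactor-insert-left {σ = σ} p≢q Ip Iq v avoids)
  step : Dec (J ≡ I) →
    coeff ((c , insert J p) ∷ (sgn σ *ℤ c , insert J q) ∷ rest) (insert I p) ≡ coeff ((c , J) ∷ v) I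
  step (yes refl) = begin
    coeff ((c , insert I p) ∷ (sgn σ *ℤ c , insert I q) ∷ rest) (insert I p)
      ≡⟨ coeff-head c (insert I p) ((sgn σ *ℤ c , insert I q) ∷ rest) ⟩
    c +ℤ coeff ((sgn σ *ℤ c , insert I q) ∷ rest) (insert I p)
      ≡⟨ cong (c +ℤ_) rest-coeff ⟩
    c +ℤ coeff v I
      ≡⟨ coeff-head c I v ⟨
    coeff ((c , I) ∷ v) I ∎
  step (no J≢I) = begin
    coeff ((c , insert J p) ∷ (sgn σ *ℤ c , insert J q) ∷ rest) (insert I p)
      ≡⟨ coeff-skip c (insert J p) (insert I p) _ (J≢I ∘ insert-cancel Jp Ip) ⟩
    coeff ((sgn σ *ℤ c , insert J q) ∷ rest) (insert I p)
      ≡⟨ rest-coeff ⟩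
    coeff v I
      ≡⟨ coeff-skip c J I v J≢I ⟨
    coeff ((c , J) ∷ v) I ∎

coeff-mulFactor-insert-right : p ≢ q → lookup I p ≡ false → lookup I q ≡ false →
  (v : Vect n) → Avoids q v → coeff (mulFactor (p , q , σ) v) (insert I q) ≡ sgn σ *ℤ coeff v I
coeff-mulFactor-insert-right {σ = σ} p≢q Ip Iq [] [] = sym (ℤ.*-zeroʳ (sgn σ))
coeff-mulFactor-insert-right {p = p} {q = q} {I = I} {σ = σ} p≢q Ip Iq ((c , J) ∷ v) (Jq ∷ avoids) =
  begin
    coeff ((c , insert J p) ∷ (sgn σ *ℤ c , insert J q) ∷ rest) (insert I q)
      ≡⟨ coeff-skip c (insert J p) (insert I q) _ (insert-≢ Ip (p≢q ∘ sym)) ⟩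
    coeff ((sgn σ *ℤ c , insert J q) ∷ rest) (insert I q)
      ≡⟨ step (≡-dec Bool._≟_ J I) ⟩
    sgn σ *ℤ coeff ((c , J) ∷ v) I ∎
  where
  open ≡-Reasoning
  rest : Vect _
  rest = mulFactor (p , q , σ) v
  rest-coeff : coeff rest (insert I q) ≡ sgn σ *ℤ coeff v I
  rest-coeff = coeff-mulFactor-insert-right {σ = σ} p≢q Ip Iq v avoids
  step : Dec (J ≡ I) →
    coeff ((sgn σ *ℤ c , insert J q) ∷ rest) (insert I q) ≡ sgn σ *ℤ coeff ((c , J) ∷ v) I
  step (yes refl) = begin
    coeff ((sgn σ *ℤ c , insert I q) ∷ rest) (insert I q)
      ≡⟨ coeff-head (sgn σ *ℤ c) (insert I q) rest ⟩
    sgn σ *ℤ c +ℤ coeff rest (insert I q)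
      ≡⟨ cong (sgn σ *ℤ c +ℤ_) rest-coeff ⟩
    sgn σ *ℤ c +ℤ sgn σ *ℤ coeff v I
      ≡⟨ ℤ.*-distribˡ-+ (sgn σ) c (coeff v I) ⟨
    sgn σ *ℤ (c +ℤ coeff v I)
      ≡⟨ cong (sgn σ *ℤ_) (coeff-head c I v) ⟨
    sgn σ *ℤ coeff ((c , I) ∷ v) I ∎
  step (no J≢I) = begin
    coeff ((sgn σ *ℤ c , insert J q) ∷ rest) (insert I q)
      ≡⟨ coeff-skip (sgn σ *ℤ c) (insert J q) (insert I q) rest (J≢I ∘ insert-cancel Jq Iq) ⟩
    coeff rest (insert I q)
      ≡⟨ rest-coeff ⟩
    sgn σ *ℤ coeff v I
      ≡⟨ cong (sgn σ *ℤ_) (coeff-skip c J I v J≢I) ⟨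
    sgn σ *ℤ coeff ((c , J) ∷ v) I ∎

All-mulFactor : {P Q : Subset n → Set} (σ : Sign) →
  (∀ {J} → P J → Q (insert J p) × Q (insert J q)) →
  (v : Vect n) → All (P ∘ proj₂) v → All (Q ∘ proj₂) (mulFactor (p , q , σ) v)
All-mulFactor σ step [] [] = []
All-mulFactor σ step ((c , J) ∷ v) (PJ ∷ Pv) =
  let (Q-left , Q-right) = step PJ in Q-left ∷ Q-right ∷ All-mulFactor σ step v Pv

Fresh : Fin n → List (Factor n) → Set
Fresh x gs = All (x ≢_) (indices gs)

expand-avoids : (gs : List (Factor n)) → Fresh x gs → Avoids x (expand gs)
expand-avoids {x = x} [] [] = lookup-∅ x ∷ []
expand-avoids {x = x} ((p , q , σ) ∷ gs) (x≢p ∷ x≢q ∷ fresh) =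
  All-mulFactor σ (λ {J} Jx → trans (lookup-insert-≢ J (x≢p ∘ sym)) Jx ,
                              trans (lookup-insert-≢ J (x≢q ∘ sym)) Jx)
                (expand gs) (expand-avoids gs fresh)

-- I is the ≺-least monomial of expand gs and e its coefficient (leading-least, leading-coeff).
data Leading {n : ℕ} : List (Factor n) → Subset n → ℤ → Set where
  []         : Leading [] ∅ 1ℤ
  ascending  : p <ᶠ q → Leading gs I e → Leading ((p , q , σ) ∷ gs) (insert I p) e
  descending : q <ᶠ p → Leading gs I e → Leading ((p , q , σ) ∷ gs) (insert I q) (sgn σ *ℤ e)

leading : (gs : List (Factor n)) → Unique (indices gs) → ∃₂ (Leading gs)
leading [] _ = ∅ , 1ℤ , []
leading ((p , q , σ) ∷ gs) ((p≢q ∷ _) ∷ _ ∷ unique) with leading gs unique | <-cmp p q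
... | I , e , lead | tri< p<q _ _ = insert I p , e , ascending p<q lead
... | _ , _ , _    | tri≈ _ p≡q _ = ⊥-elim (p≢q p≡q)
... | I , e , lead | tri> _ _ q<p = insert I q , sgn σ *ℤ e , descending q<p lead

leading-fresh : Leading gs I e → Fresh x gs → lookup I x ≡ false
leading-fresh {x = x} [] [] = lookup-∅ x
leading-fresh (ascending {I = I} _ lead) (x≢p ∷ _ ∷ fresh) =
  trans (lookup-insert-≢ I (x≢p ∘ sym)) (leading-fresh lead fresh)
leading-fresh (descending {I = I} _ lead) (_ ∷ x≢q ∷ fresh) =
  trans (lookup-insert-≢ I (x≢q ∘ sym)) (leading-fresh lead fresh)

leading-card : {n : ℕ} {gs : List (Factor n)} {I : Subset n} →
  Unique (indices gs) → Leading gs I e → ∣ I ∣ ≡ length gs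
leading-card {n = n} _ [] = ∣⊥∣≡0 n
leading-card ((_ ∷ p-fresh) ∷ _ ∷ unique) (ascending {p = p} {I = I} _ lead) =
  trans (∣insert∣ I p (leading-fresh lead p-fresh)) (cong suc (leading-card unique lead))
leading-card ((_ ∷ _) ∷ q-fresh ∷ unique) (descending {q = q} {I = I} _ lead) =
  trans (∣insert∣ I q (leading-fresh lead q-fresh)) (cong suc (leading-card unique lead))

leading-coeff : {n : ℕ} {gs : List (Factor n)} {I : Subset n} →
  Unique (indices gs) → Leading gs I e → coeff (expand gs) I ≡ e
leading-coeff {n = n} _ [] = coeff-head 1ℤ (∅ {n}) []
leading-coeff {gs = (p , q , σ) ∷ gs} ((p≢q ∷ p-fresh) ∷ q-fresh ∷ unique) (ascending _ lead) =
  trans (coeff-mulFactor-insert-left {σ = σ} p≢q (leading-fresh lead p-fresh) (leading-fresh lead q-fresh)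
           (expand gs) (expand-avoids gs p-fresh))
        (leading-coeff unique lead)
leading-coeff {gs = (p , q , σ) ∷ gs} ((p≢q ∷ p-fresh) ∷ q-fresh ∷ unique) (descending _ lead) =
  trans (coeff-mulFactor-insert-right {σ = σ} p≢q (leading-fresh lead p-fresh) (leading-fresh lead q-fresh)
           (expand gs) (expand-avoids gs q-fresh))
        (cong (sgn σ *ℤ_) (leading-coeff unique lead))

leading-least : Unique (indices gs) → Leading gs I e → All ((I ⊑_) ∘ proj₂) (expand gs)
leading-least _ [] = inj₁ refl ∷ []
leading-least {gs = (p , q , σ) ∷ gs} ((_ ∷ p-fresh) ∷ _ ∷ unique) (ascending {I = I} p<q lead) =
  All-mulFactor σ (λ (I⊑J , Jp) → insert-mono-⊑ Ip I⊑J , inj₂ (insert-⊏-insert p<q Ip Jp I⊑J))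
    (expand gs) (All.zip (leading-least unique lead , expand-avoids gs p-fresh))
  where
  Ip : lookup I p ≡ false
  Ip = leading-fresh lead p-fresh
leading-least {gs = (p , q , σ) ∷ gs} (_ ∷ q-fresh ∷ unique) (descending {I = I} q<p lead) =
  All-mulFactor σ (λ (I⊑J , Jq) → inj₂ (insert-⊏-insert q<p Iq Jq I⊑J) , insert-mono-⊑ Iq I⊑J)
    (expand gs) (All.zip (leading-least unique lead , expand-avoids gs q-fresh))
  where
  Iq : lookup I q ≡ false
  Iq = leading-fresh lead q-fresh

leading-unit : Leading gs I e → e ≡ 1ℤ ⊎ e ≡ -1ℤ
leading-unit [] = inj₁ refl
leading-unit (ascending _ lead) = leading-unit lead
leading-unit (descending {σ = plus} _ lead) with leading-unit lead
... | inj₁ refl = inj₁ refl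
... | inj₂ refl = inj₂ refl
leading-unit (descending {σ = minus} _ lead) with leading-unit lead
... | inj₁ refl = inj₂ refl
... | inj₂ refl = inj₁ refl

leading-inverted : Leading gs I e → e <ℤ 0ℤ →
  ∃₂ λ p q → (p , q , minus) ∈ gs × q <ᶠ p
leading-inverted [] (+<+ ())
leading-inverted (ascending _ lead) e<0 = map₂ (map₂ (map₁ there)) (leading-inverted lead e<0)
leading-inverted (descending {σ = minus} q<p _) _ = _ , _ , here refl , q<p
leading-inverted (descending {e = e} {σ = plus} _ lead) 1e<0 =
  map₂ (map₂ (map₁ there)) (leading-inverted lead (subst (_<ℤ 0ℤ) (ℤ.*-identityˡ e) 1e<0))

-- Every other term lies ≻ I, so the ≺-minimal monomial with nonzero coefficient is I.
leading-negative : {k : ℕ} → Unique (indices gs) → Leading gs I e → length gs ≡ k →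
  Negative k (expand gs) → e <ℤ 0ℤ
leading-negative {gs = gs} {I = I} {e = e} unique lead len (J , _ , J<0 , below-J-zero)
  with coeff≢0⇒∈ (expand gs) J (ℤ.<⇒≢ J<0)
... | _ , term with All.lookup (leading-least unique lead) term
...   | inj₁ refl = subst (_<ℤ 0ℤ) (leading-coeff unique lead) J<0
...   | inj₂ I⊏J = ⊥-elim (unit≢0 (leading-unit lead) e≡0)
  where
  e≡0 : e ≡ 0ℤ
  e≡0 = trans (sym (leading-coeff unique lead))
              (below-J-zero I (trans (leading-card unique lead) len) (⊏⇒≺ I⊏J))
  unit≢0 : e ≡ 1ℤ ⊎ e ≡ -1ℤ → e ≢ 0ℤ
  unit≢0 (inj₁ refl) ()
  unit≢0 (inj₂ refl) ()

permuteFactor : Permutation′ n → Factor n → Factor n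
permuteFactor w (i , j , σ) = w ⟨$⟩ʳ i , w ⟨$⟩ʳ j , σ

lookup-image : (w : Permutation′ n) (I : Subset n) (t : Fin n) →
  lookup (image w I) t ≡ lookup I (w ⟨$⟩ˡ t)
lookup-image w I t = lookup∘tabulate (λ u → lookup I (w ⟨$⟩ˡ u)) t

image-∅ : (w : Permutation′ n) → image w ∅ ≡ ∅
image-∅ w = subset-ext λ t →
  trans (lookup-image w ∅ t) (trans (lookup-∅ (w ⟨$⟩ˡ t)) (sym (lookup-∅ t)))

image-insert : (w : Permutation′ n) (I : Subset n) (i : Fin n) →
  image w (insert I i) ≡ insert (image w I) (w ⟨$⟩ʳ i)
image-insert w I i = subset-ext pointwise
  where
  open ≡-Reasoning
  pointwise : ∀ t → lookup (image w (insert I i)) t ≡ lookup (insert (image w I) (w ⟨$⟩ʳ i)) t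
  pointwise t with (w ⟨$⟩ʳ i) ≟ t
  ... | yes refl = begin
    lookup (image w (insert I i)) (w ⟨$⟩ʳ i) ≡⟨ lookup-image w (insert I i) (w ⟨$⟩ʳ i) ⟩
    lookup (insert I i) (w ⟨$⟩ˡ (w ⟨$⟩ʳ i))  ≡⟨ cong (lookup (insert I i)) (inverseˡ w) ⟩
    lookup (insert I i) i                    ≡⟨ lookup-insert I i ⟩
    true                                     ≡⟨ lookup-insert (image w I) (w ⟨$⟩ʳ i) ⟨
    lookup (insert (image w I) (w ⟨$⟩ʳ i)) (w ⟨$⟩ʳ i) ∎
  ... | no wi≢t = begin
    lookup (image w (insert I i)) t           ≡⟨ lookup-image w (insert I i) t ⟩
    lookup (insert I i) (w ⟨$⟩ˡ t)            ≡⟨ lookup-insert-≢ I i≢w⁻¹t ⟩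
    lookup I (w ⟨$⟩ˡ t)                       ≡⟨ lookup-image w I t ⟨
    lookup (image w I) t                      ≡⟨ lookup-insert-≢ (image w I) wi≢t ⟨
    lookup (insert (image w I) (w ⟨$⟩ʳ i)) t ∎
    where
    i≢w⁻¹t : i ≢ w ⟨$⟩ˡ t
    i≢w⁻¹t i≡w⁻¹t = wi≢t (trans (cong (w ⟨$⟩ʳ_) i≡w⁻¹t) (inverseʳ w))

act-mulFactor : (w : Permutation′ n) (f : Factor n) (v : Vect n) →
  act w (mulFactor f v) ≡ mulFactor (permuteFactor w f) (act w v)
act-mulFactor w f [] = refl
act-mulFactor w f@(i , j , σ) ((c , J) ∷ v) =
  cong₂ _∷_ (cong (c ,_) (image-insert w J i))
    (cong₂ _∷_ (cong (sgn σ *ℤ c ,_) (image-insert w J j)) (act-mulFactor w f v))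

act-expand : (w : Permutation′ n) (fs : List (Factor n)) →
  act w (expand fs) ≡ expand (map (permuteFactor w) fs)
act-expand w [] = cong (λ K → (1ℤ , K) ∷ []) (image-∅ w)
act-expand w (f ∷ fs) =
  trans (act-mulFactor w f (expand fs)) (cong (mulFactor (permuteFactor w f)) (act-expand w fs))

indices-permute : (w : Permutation′ n) (fs : List (Factor n)) →
  indices (map (permuteFactor w) fs) ≡ map (w ⟨$⟩ʳ_) (indices fs)
indices-permute w [] = refl
indices-permute w ((i , j , σ) ∷ fs) =
  cong (λ is → (w ⟨$⟩ʳ i) ∷ (w ⟨$⟩ʳ j) ∷ is) (indices-permute w fs)

unique-permute : (w : Permutation′ n) (fs : List (Factor n)) →
  Unique (indices fs) → Unique (indices (map (permuteFactor w) fs))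
unique-permute w fs unique =
  subst Unique (sym (indices-permute w fs)) (Unique.map⁺ w-injective unique)
  where
  w-injective : ∀ {a b} → w ⟨$⟩ʳ a ≡ w ⟨$⟩ʳ b → a ≡ b
  w-injective eq = trans (sym (inverseˡ w)) (trans (cong (w ⟨$⟩ˡ_) eq) (inverseˡ w))

inverted-minus-factor : {k : ℕ} (w : Permutation′ n) (fs : List (Factor n)) →
  Unique (indices fs) → length fs ≡ k → Negative k (act w (expand fs)) →
  ∃₂ λ i j → (i , j , minus) ∈ fs × w ⟨$⟩ʳ j <ᶠ w ⟨$⟩ʳ i
inverted-minus-factor {k = k} w fs unique len negative
  with unique-permute w fs unique
... | unique′ with leading (map (permuteFactor w) fs) unique′
... | _ , _ , lead
  with leading-inverted lead
         (leading-negative unique′ lead (trans (length-map (permuteFactor w) fs) len)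
            (subst (Negative k) (act-expand w fs) negative))
... | _ , _ , inverted , q<p with ∈-map⁻ (permuteFactor w) inverted
... | (i , j , _) , factor , refl = i , j , factor , q<p

lemma4p3 : (n k : ℕ) → 2 ≤ n → 0 < k → 2 * k ≤ n →
    (α : NormalForm n k) → Positive k (rootVec α) →
    (w : Permutation′ n) → Negative k (act w (rootVec α)) →
    Σ (Fin n) λ i → Σ (Fin n) λ j →
    ((i , j , minus) ∈ factors α) × ((w ⟨$⟩ʳ i) > (w ⟨$⟩ʳ j))
lemma4p3 n k _ _ _ α _ w = inverted-minus-factor w (factors α) (distinct α) (len α)
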